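{- Let $\mathcal{N}=(\Omega,\mathcal{L})$ be an $(n,k)$-net with $k<n$ and let $H$ be an abelian group of weak automorphisms of $\mathcal{N}$ acting regularly on $\Omega$. Then every element of $H$ is a strong automorphism of $\mathcal{N}$.
   Context: An $(n,k)$-net $\mathcal{N}=(\Omega,\mathcal{L})$ consists of a set $\Omega$ of $n^2$ points and a set $\mathcal{L}$ of $kn$ lines (subsets of $\Omega$) such that each line contains $n$ points, $\mathcal{L}$ is partitioned into $k$ parallel classes $\mathcal{L}_1,\dots,\mathcal{L}_k$, and any two lines from distinct parallel classes meet in exactly one point. A weak automorphism is a permutation of $\Omega$ mapping $\mathcal{L}$ onto itself; a strong automorphism is a weak automorphism that maps each parallel class $\mathcal{L}_i$ onto itself. -}

module Defs where

open import Level using (Level)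
open import Data.Nat using (ℕ; _*_)
open import Data.Fin using (Fin)
open import Data.Fin.Subset using (Subset; _∈_; _∩_; ∣_∣)
open import Data.Product using (Σ; _×_; ∃; ∃₂)
open import Relation.Binary.PropositionalEquality using (_≡_; _≢_)
open import Function.Bundles using (_⇔_)
open import Function.Definitions using (Bijective)
open import Algebra.Bundles using (AbelianGroup)

-- The point set Ω is (a relabelling of) Fin (n * n).
Point : ℕ → Set
Point n = Fin (n * n)

-- An (n,k)-net: lines indexed by parallel class i : Fin k and position a : Fin n.
record Net (n k : ℕ) : Set where
  field
    line          : Fin k → Fin n → Subset (n * n)
    line-distinct : ∀ i a j b → line i a ≡ line j b → (i ≡ j) × (a ≡ b)
    line-size     : ∀ i a → ∣ line i a ∣ ≡ n
    line-meet     : ∀ i j → i ≢ j → ∀ a b → ∣ line i a ∩ line j b ∣ ≡ 1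

MapsOnto : ∀ {N} → (Fin N → Fin N) → Subset N → Subset N → Set
MapsOnto σ L M = ∀ x → (x ∈ L) ⇔ (σ x ∈ M)

module _ {n k : ℕ} (𝒩 : Net n k) where
  open Net 𝒩

  IsWeakAut : (Point n → Point n) → Set
  IsWeakAut σ = Bijective _≡_ _≡_ σ
              × (∀ i a → ∃₂ λ j b → MapsOnto σ (line i a) (line j b))
              × (∀ j b → ∃₂ λ i a → MapsOnto σ (line i a) (line j b))

  IsStrongAut : (Point n → Point n) → Set
  IsStrongAut σ = IsWeakAut σ
                × (∀ i a → ∃ λ b → MapsOnto σ (line i a) (line i b))
                × (∀ i b → ∃ λ a → MapsOnto σ (line i a) (line i b))

record RegularAbelianWeakAutGroup {c ℓ : Level} {n k : ℕ} (𝒩 : Net n k)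
                                  (H : AbelianGroup c ℓ) : Set (c Level.⊔ ℓ) where
  open AbelianGroup H
  field
    act       : Carrier → Point n → Point n
    act-cong  : ∀ {g h} → g ≈ h → ∀ x → act g x ≡ act h x
    act-ε     : ∀ x → act ε x ≡ x
    act-∙     : ∀ g h x → act (g ∙ h) x ≡ act g (act h x)
    faithful  : ∀ g h → (∀ x → act g x ≡ act h x) → g ≈ h
    weak      : ∀ g → IsWeakAut 𝒩 (act g)
    transitive : ∀ x y → Σ Carrier λ g → act g x ≡ y
    semiregular : ∀ g h x → act g x ≡ act h x → g ≈ h

{-# OPTIONS --safe #-}

-- Suppose h ∈ H mapped a line L onto a line N of another parallel class.
-- Fix a point p. The n² elements g_y of H with g_y p = y send L to only
-- kn < n² possible lines, so two of them agree on L, and their quotient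
-- s is a fixed-point-free element of H (regularity) stabilising L.
-- As H is abelian, s also stabilises N = hL, so s fixes the unique point
-- of L ∩ N: a contradiction.

module Submission where

open import Defs
open import Level using (Level)
open import Data.Nat using (ℕ; _<_; _*_; z≤n; >-nonZero)
open import Data.Nat.Properties using (suc-injective; *-monoˡ-<; ≤-<-trans)
open import Data.Fin using (Fin; zero; suc; fromℕ<; combine; _≟_) renaming (_<_ to _<ᶠ_)
open import Data.Fin.Properties using (pigeonhole; combine-injective; <⇒≢)
open import Data.Fin.Subset using (Subset; _∈_; _∩_; ∣_∣; ⁅_⁆; inside; outside)
import Data.Fin.Subset as Subset
open import Data.Fin.Subset.Properties using (x∈p∩q⁺; x∈p∩q⁻; x∈⁅x⁆; x∈⁅y⁆⇒x≡y)
open import Data.Vec using (_∷_; [])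
open import Data.Product using (_×_; _,_; proj₁; proj₂; ∃; ∃₂)
open import Data.Empty using (⊥-elim)
open import Relation.Nullary using (yes; no; ¬_)
open import Relation.Binary.PropositionalEquality
open import Function.Bundles using (mk⇔; Equivalence)
open import Algebra.Bundles using (AbelianGroup)

open Equivalence using (to; from)

∣p∣≡0⇒p≡⊥ : ∀ {N} {p : Subset N} → ∣ p ∣ ≡ 0 → p ≡ Subset.⊥
∣p∣≡0⇒p≡⊥ {p = []}          _ = refl
∣p∣≡0⇒p≡⊥ {p = outside ∷ p} e = cong (outside ∷_) (∣p∣≡0⇒p≡⊥ e)

∣p∣≡1⇒p≡⁅x⁆ : ∀ {N} {p : Subset N} → ∣ p ∣ ≡ 1 → ∃ λ x → p ≡ ⁅ x ⁆
∣p∣≡1⇒p≡⁅x⁆ {p = inside ∷ p}  e = zero , cong (inside ∷_) (∣p∣≡0⇒p≡⊥ (suc-injective e))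
∣p∣≡1⇒p≡⁅x⁆ {p = outside ∷ p} e with x , p≡⁅x⁆ ← ∣p∣≡1⇒p≡⁅x⁆ e = suc x , cong (outside ∷_) p≡⁅x⁆

MapsInto : ∀ {N} → (Fin N → Fin N) → Subset N → Subset N → Set
MapsInto σ L M = ∀ {x} → x ∈ L → σ x ∈ M

module _ {N : ℕ} {L M : Subset N} where

  MapsOnto-inverse : ∀ {σ τ : Fin N → Fin N} →
                     (∀ x → τ (σ x) ≡ x) → MapsOnto τ M L → MapsOnto σ L M
  MapsOnto-inverse {σ} {τ} τσ≗id τML x = mk⇔
    (λ x∈L → from (τML (σ x)) (subst (_∈ L) (sym (τσ≗id x)) x∈L))
    (λ σx∈M → subst (_∈ L) (τσ≗id x) (to (τML (σ x)) σx∈M))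

  MapsInto-quotient : ∀ {σ τ ρ : Fin N → Fin N} → (∀ x → τ (ρ x) ≡ σ x) →
                      MapsOnto σ L M → MapsOnto τ L M → MapsInto ρ L L
  MapsInto-quotient {σ} {τ} {ρ} τρ≗σ σLM τLM {x} x∈L =
    from (τLM (ρ x)) (subst (_∈ M) (sym (τρ≗σ x)) (to (σLM x) x∈L))

  MapsInto-conjugate : ∀ {σ τ τ⁻¹ : Fin N → Fin N} →
                       (∀ y → τ (τ⁻¹ y) ≡ y) → (∀ x → σ (τ x) ≡ τ (σ x)) →
                       MapsOnto τ L M → MapsInto σ L L → MapsInto σ M M
  MapsInto-conjugate {σ} {τ} {τ⁻¹} ττ⁻¹≗id στ≗τσ τLM σLL {y} y∈M =
    subst (_∈ M) τστ⁻¹y≡σy (to (τLM (σ (τ⁻¹ y))) (σLL τ⁻¹y∈L))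
    where
    τ⁻¹y∈L : τ⁻¹ y ∈ L
    τ⁻¹y∈L = from (τLM (τ⁻¹ y)) (subst (_∈ M) (sym (ττ⁻¹≗id y)) y∈M)
    τστ⁻¹y≡σy : τ (σ (τ⁻¹ y)) ≡ σ y
    τστ⁻¹y≡σy = trans (sym (στ≗τσ (τ⁻¹ y))) (cong σ (ττ⁻¹≗id y))

  fixedPoint-of-∣∩∣≡1 : ∀ {σ : Fin N → Fin N} → ∣ L ∩ M ∣ ≡ 1 →
                        MapsInto σ L L → MapsInto σ M M → ∃ λ x → σ x ≡ x
  fixedPoint-of-∣∩∣≡1 {σ} ∣L∩M∣≡1 σLL σMM with x , L∩M≡⁅x⁆ ← ∣p∣≡1⇒p≡⁅x⁆ ∣L∩M∣≡1 =
    x , x∈⁅y⁆⇒x≡y x (subst (σ x ∈_) L∩M≡⁅x⁆ (x∈p∩q⁺ (σLL x∈L , σMM x∈M)))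
    where
    x∈L∩M : x ∈ L ∩ M
    x∈L∩M = subst (x ∈_) (sym L∩M≡⁅x⁆) (x∈⁅x⁆ x)
    x∈L : x ∈ L
    x∈L = proj₁ (x∈p∩q⁻ L M x∈L∩M)
    x∈M : x ∈ M
    x∈M = proj₂ (x∈p∩q⁻ L M x∈L∩M)

module RegularAbelianAction {c ℓ : Level} {n k : ℕ} {𝒩 : Net n k} {H : AbelianGroup c ℓ}
                            (R : RegularAbelianWeakAutGroup 𝒩 H) where
  open Net 𝒩
  open AbelianGroup H using (Carrier; _≈_; _∙_; _⁻¹; inverseˡ; inverseʳ; comm)
  open RegularAbelianWeakAutGroup R

  act-inverseʳ : ∀ g y → act g (act (g ⁻¹) y) ≡ y
  act-inverseʳ g y = trans (sym (act-∙ g (g ⁻¹) y)) (trans (act-cong (inverseʳ g) y) (act-ε y))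

  act-inverseˡ : ∀ g x → act (g ⁻¹) (act g x) ≡ x
  act-inverseˡ g x = trans (sym (act-∙ (g ⁻¹) g x)) (trans (act-cong (inverseˡ g) x) (act-ε x))

  act-comm : ∀ g h x → act g (act h x) ≡ act h (act g x)
  act-comm g h x = trans (sym (act-∙ g h x)) (trans (act-cong (comm g h) x) (act-∙ h g x))

  lineImage : ∀ g i a → ∃ λ j → ∃ λ b → MapsOnto (act g) (line i a) (line j b)
  lineImage g = proj₁ (proj₂ (weak g))

  stabiliser-of-collision : ∀ {g₁ g₂ L M} →
    MapsOnto (act g₁) L M → MapsOnto (act g₂) L M → ¬ g₁ ≈ g₂ →
    ∃ λ s → MapsInto (act s) L L × (∀ x → act s x ≢ x)
  stabiliser-of-collision {g₁} {g₂} g₁LM g₂LM g₁≉g₂ =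
    g₂ ⁻¹ ∙ g₁ , MapsInto-quotient g₂s≗g₁ g₁LM g₂LM ,
    λ x sx≡x → g₁≉g₂ (semiregular g₁ g₂ x (trans (sym (g₂s≗g₁ x)) (cong (act g₂) sx≡x)))
    where
    g₂s≗g₁ : ∀ x → act g₂ (act (g₂ ⁻¹ ∙ g₁) x) ≡ act g₁ x
    g₂s≗g₁ x = trans (cong (act g₂) (act-∙ (g₂ ⁻¹) g₁ x)) (act-inverseʳ g₂ (act g₁ x))

  fixedPointFree-stabiliser : k < n → ∀ i a →
    ∃ λ s → MapsInto (act s) (line i a) (line i a) × (∀ x → act s x ≢ x)
  fixedPointFree-stabiliser k<n i a = stabiliser (pigeonhole kn<nn lineOf)
    where
    kn<nn : k * n < n * n
    kn<nn = *-monoˡ-< n {{>-nonZero (≤-<-trans z≤n k<n)}} k<n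
    p : Point n
    p = fromℕ< (≤-<-trans z≤n kn<nn)
    translation : Point n → Carrier
    translation y = proj₁ (transitive p y)
    translation-injective : ∀ {y₁ y₂} → translation y₁ ≈ translation y₂ → y₁ ≡ y₂
    translation-injective {y₁} {y₂} g₁≈g₂ = begin
      y₁                     ≡⟨ sym (proj₂ (transitive p y₁)) ⟩
      act (translation y₁) p ≡⟨ act-cong g₁≈g₂ p ⟩
      act (translation y₂) p ≡⟨ proj₂ (transitive p y₂) ⟩
      y₂                     ∎
      where open ≡-Reasoning
    lineIndex : Point n → Fin k
    lineIndex y = proj₁ (lineImage (translation y) i a)
    linePos : Point n → Fin n
    linePos y = proj₁ (proj₂ (lineImage (translation y) i a))
    lineImageOf : ∀ y → MapsOnto (act (translation y)) (line i a) (line (lineIndex y) (linePos y))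
    lineImageOf y = proj₂ (proj₂ (lineImage (translation y) i a))
    lineOf : Point n → Fin (k * n)
    lineOf y = combine (lineIndex y) (linePos y)
    stabiliser : (∃₂ λ y₁ y₂ → y₁ <ᶠ y₂ × lineOf y₁ ≡ lineOf y₂) →
                 ∃ λ s → MapsInto (act s) (line i a) (line i a) × (∀ x → act s x ≢ x)
    stabiliser (y₁ , y₂ , y₁<y₂ , same-line) =
      stabiliser-of-collision (lineImageOf y₁)
        (subst (MapsOnto _ (line i a)) (sym same-image) (lineImageOf y₂))
        (λ g₁≈g₂ → <⇒≢ y₁<y₂ (translation-injective g₁≈g₂))
      where
      same-image : line (lineIndex y₁) (linePos y₁) ≡ line (lineIndex y₂) (linePos y₂)
      same-image
        with j₁≡j₂ , b₁≡b₂ ← combine-injective (lineIndex y₁) (linePos y₁)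
                                               (lineIndex y₂) (linePos y₂) same-line
        = cong₂ line j₁≡j₂ b₁≡b₂

  class-preserved : k < n → ∀ h {i a j b} → MapsOnto (act h) (line i a) (line j b) → i ≡ j
  class-preserved k<n h {i} {a} {j} {b} hLN with i ≟ j
  ... | yes i≡j = i≡j
  ... | no i≢j
    with s , sLL , s-fixedPointFree ← fixedPointFree-stabiliser k<n i a
    with x , sx≡x ← fixedPoint-of-∣∩∣≡1 (line-meet i j i≢j a b) sLL
                      (MapsInto-conjugate (act-inverseʳ h) (act-comm s h) hLN sLL)
    = ⊥-elim (s-fixedPointFree x sx≡x)

  image-in-class : k < n → ∀ h i a → ∃ λ b → MapsOnto (act h) (line i a) (line i b)
  image-in-class k<n h i a with j , b , hLN ← lineImage h i a
    with refl ← class-preserved k<n h hLN = b , hLN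

  preimage-in-class : k < n → ∀ h i b → ∃ λ a → MapsOnto (act h) (line i a) (line i b)
  preimage-in-class k<n h i b with a , h⁻¹NL ← image-in-class k<n (h ⁻¹) i b =
    a , MapsOnto-inverse (act-inverseˡ h) h⁻¹NL

proposition6p7 : ∀ {c ℓ : Level} (n k : ℕ) → k < n → (𝒩 : Net n k)
    → (H : AbelianGroup c ℓ) → (R : RegularAbelianWeakAutGroup 𝒩 H)
    → ∀ (h : AbelianGroup.Carrier H) → IsStrongAut 𝒩 (RegularAbelianWeakAutGroup.act R h)
proposition6p7 n k k<n 𝒩 H R h =
  weak h , image-in-class k<n h , preimage-in-class k<n h
  where open RegularAbelianWeakAutGroup R using (weak)
        open RegularAbelianAction R
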